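{- Let $G=\boxtimes_iG_i$ be a thin strong product graph, let $H\subseteq G$ be a non-thin subproduct of $G$, and let $x\in V(H)$ be a vertex with $|S_H(x)|=1$. Let $P_H$ be a partial product coloring of $H$. Then, for every color $c$ in the image of $P_H$, vertex $x$ is contained in at least one edge with color $c$.
   Context: All graphs are finite, simple, connected, undirected. $N[v]$ is the closed neighborhood of $v$ in $G$. A graph is thin if no two distinct vertices have equal closed neighborhoods. The strong product $\boxtimes_iG_i$ has vertex set $\times_iV(G_i)$; distinct vertices are adjacent iff in each coordinate they are equal or adjacent. A subproduct is a subgraph $\boxtimes_iH_i$ with $H_i\subseteq G_i$. For an induced subgraph $H$ and $x\in V(H)$, $S_H(x)=\{u\in V(H): N[u]\cap V(H)=N[x]\cap V(H)\}$. An edge $(a,b)$ satisfies the S1-condition in $H$ if $a,b\in V(H)$ and $|S_H(a)|=1$ or $|S_H(b)|=1$. A partial product coloring of a graph $H$ with a representation $H=\boxtimes_{i=1}^kK_i$ ($k\ge1$, factors not necessarily prime) is the map on the Cartesian edges of $H$ that satisfy the S1-condition in $H$ assigning color $i$ to such an edge lying in a $K_i$-fiber. An edge is Cartesian if its endpoints differ in exactly one coordinate. -}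

module Defs where

open import Data.Nat using (ℕ; _<_; _≥_)
open import Data.Fin using (Fin)
open import Data.Fin.Subset using (Subset; _∈_; ⊤)
open import Data.Product using (Σ; ∃; ∃₂; _×_; _,_)
open import Data.Sum using (_⊎_)
open import Relation.Nullary using (¬_; Dec)
open import Relation.Binary.PropositionalEquality using (_≡_; _≢_)
open import Function.Bundles using (_⇔_)

record Graph : Set₁ where
  field
    n        : ℕ
    Adj      : Fin n → Fin n → Set
    adj?     : ∀ u v → Dec (Adj u v)
    sym      : ∀ {u v} → Adj u v → Adj v u
    irrefl   : ∀ {u} → ¬ Adj u u
    nonempty : 0 < n

data WalkIn (G : Graph) (U : Subset (Graph.n G)) : Fin (Graph.n G) → Fin (Graph.n G) → Set where
  here : ∀ {u} → WalkIn G U u u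
  step : ∀ {u v w} → Graph.Adj G u v → v ∈ U → WalkIn G U v w → WalkIn G U u w

ConnectedIn : (G : Graph) → Subset (Graph.n G) → Set
ConnectedIn G U = (∃ λ u → u ∈ U) × (∀ u v → u ∈ U → v ∈ U → WalkIn G U u v)

Connected : Graph → Set
Connected G = ∀ u v → WalkIn G ⊤ u v

module Prod {k : ℕ} (Gs : Fin k → Graph) where

  PVert : Set
  PVert = (i : Fin k) → Fin (Graph.n (Gs i))

  _≈P_ : PVert → PVert → Set
  u ≈P v = ∀ i → u i ≡ v i

  SAdj : PVert → PVert → Set
  SAdj u v = (∃ λ i → u i ≢ v i) × (∀ i → u i ≡ v i ⊎ Graph.Adj (Gs i) (u i) (v i))

  InN : PVert → PVert → Set
  InN u w = w ≈P u ⊎ SAdj u w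

  SameN : PVert → PVert → Set
  SameN u v = ∀ w → InN u w ⇔ InN v w

  Thin : Set
  Thin = ∀ u v → SameN u v → u ≈P v

  DiffOnlyAt : Fin k → PVert → PVert → Set
  DiffOnlyAt c u v = u c ≢ v c × (∀ j → j ≢ c → u j ≡ v j)

-- A subproduct H = ⊠ᵢ Hᵢ, Hᵢ the induced subgraph Gᵢ[Uᵢ]

module Sub {k : ℕ} (Gs : Fin k → Graph) (U : (i : Fin k) → Subset (Graph.n (Gs i))) where

  open Prod Gs

  InH : PVert → Set
  InH u = ∀ i → u i ∈ U i

  SameNH : PVert → PVert → Set
  SameNH u v = ∀ w → InH w → (InN u w ⇔ InN v w)

  -- |S_H(x)| = 1   (x ∈ S_H(x) always holds)
  SingletonS : PVert → Set
  SingletonS x = ∀ u → InH u → SameNH u x → u ≈P x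

  NonThinH : Set
  NonThinH = ∃₂ λ u v → InH u × InH v × ¬ (u ≈P v) × SameNH u v

  S1 : PVert → PVert → Set
  S1 a b = InH a × InH b × (SingletonS a ⊎ SingletonS b)

  record Representation : Set₁ where
    field
      k'      : ℕ
      k'≥1    : k' ≥ 1
      Ks      : Fin k' → Graph
      Ks-conn : ∀ i → Connected (Ks i)
      ψ       : Prod.PVert Ks → PVert
      ψ-resp  : ∀ {a b} → Prod._≈P_ Ks a b → ψ a ≈P ψ b
      ψ-inH   : ∀ a → InH (ψ a)
      ψ-inj   : ∀ {a b} → ψ a ≈P ψ b → Prod._≈P_ Ks a b
      ψ-surj  : ∀ u → InH u → ∃ λ a → ψ a ≈P u
      ψ-adj   : ∀ a b → Prod.SAdj Ks a b ⇔ SAdj (ψ a) (ψ b)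

    -- Partial product coloring P_H: the edge (u , v) of H is in the
    -- domain of P_H and receives color c.
    Colored : Fin k' → PVert → PVert → Set
    Colored c u v =
      SAdj u v × S1 u v ×
      (∃₂ λ a b → ψ a ≈P u × ψ b ≈P v × Prod.DiffOnlyAt Ks c a b)

    InImage : Fin k' → Set
    InImage c = ∃₂ λ u v → Colored c u v

open Prod public

-- A coloured
-- edge of colour c has endpoints differing in the K_c-coordinate, so K_c has two
-- distinct vertices; being connected, every vertex of K_c then has a neighbour.
-- Moving the preimage of x along such a neighbour gives a Cartesian K_c-edge at
-- x, and it satisfies the S1-condition because |S_H(x)| = 1.
module Submission where

open import Defs
open import Data.Nat using (ℕ)
open import Data.Fin using (Fin; _≟_)
open import Data.Fin.Subset using (Subset)
open import Data.Product using (∃; _×_; _,_)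
open import Data.Sum using (_⊎_; inj₁; inj₂)
open import Data.Empty using (⊥-elim)
open import Relation.Nullary using (Dec; yes; no)
open import Relation.Binary.PropositionalEquality
open import Function.Bundles using (Equivalence)

walk-between-distinct⇒∃-neighbour : ∀ {G U p t} → WalkIn G U p t → p ≢ t →
  ∃ λ w → Graph.Adj G p w
walk-between-distinct⇒∃-neighbour here                 p≢p = ⊥-elim (p≢p refl)
walk-between-distinct⇒∃-neighbour (step {v = w} p~w _ _) _  = w , p~w

connected⇒∃-neighbour : ∀ (G : Graph) → Connected G →
  ∀ {q r} → q ≢ r → ∀ p → ∃ λ w → Graph.Adj G p w
connected⇒∃-neighbour G conn {q} {r} q≢r p with p ≟ q
... | no p≢q   = walk-between-distinct⇒∃-neighbour (conn p q) p≢q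
... | yes refl = walk-between-distinct⇒∃-neighbour (conn p r) q≢r

module _ {k : ℕ} (Gs : Fin k → Graph) where

  SAdj-resp-≈P : ∀ {u v u' v'} → _≈P_ Gs u u' → _≈P_ Gs v v' →
    SAdj Gs u v → SAdj Gs u' v'
  SAdj-resp-≈P {u} {v} {u'} {v'} u≈u' v≈v' ((i , uᵢ≢vᵢ) , close) =
    (i , λ e → uᵢ≢vᵢ (trans (u≈u' i) (trans e (sym (v≈v' i))))) , close'
    where
    close' : ∀ j → u' j ≡ v' j ⊎ Graph.Adj (Gs j) (u' j) (v' j)
    close' j with close j
    ... | inj₁ e   = inj₁ (trans (sym (u≈u' j)) (trans e (v≈v' j)))
    ... | inj₂ adj = inj₂ (subst₂ (Graph.Adj (Gs j)) (u≈u' j) (v≈v' j) adj)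

  _[_≔_] : PVert Gs → (c : Fin k) → Fin (Graph.n (Gs c)) → PVert Gs
  (a [ c ≔ w ]) j with j ≟ c
  ... | yes refl = w
  ... | no _     = a j

  [≔]-updated : ∀ a c w → (a [ c ≔ w ]) c ≡ w
  [≔]-updated a c w with c ≟ c
  ... | yes refl = refl
  ... | no c≢c   = ⊥-elim (c≢c refl)

  [≔]-unchanged : ∀ a c w j → j ≢ c → a j ≡ (a [ c ≔ w ]) j
  [≔]-unchanged a c w j j≢c with j ≟ c
  ... | yes refl = ⊥-elim (j≢c refl)
  ... | no _     = refl

  cartesian-neighbour : ∀ a c {w} → Graph.Adj (Gs c) (a c) w →
    ∃ λ b → SAdj Gs a b × DiffOnlyAt Gs c a b
  cartesian-neighbour a c {w} aᶜ~w =
    a [ c ≔ w ] , ((c , differs) , close) , differs , [≔]-unchanged a c w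
    where
    aᶜ~updated : Graph.Adj (Gs c) (a c) ((a [ c ≔ w ]) c)
    aᶜ~updated = subst (Graph.Adj (Gs c) (a c)) (sym ([≔]-updated a c w)) aᶜ~w

    differs : a c ≢ (a [ c ≔ w ]) c
    differs e = Graph.irrefl (Gs c) (subst (Graph.Adj (Gs c) (a c)) (sym e) aᶜ~updated)

    close : ∀ j → a j ≡ (a [ c ≔ w ]) j ⊎ Graph.Adj (Gs j) (a j) ((a [ c ≔ w ]) j)
    -- A 'with j ≟ c' here would also abstract the test inside a [ c ≔ w ] and leave it stuck.
    close j = by-cases (j ≟ c)
      where
      by-cases : Dec (j ≡ c) → a j ≡ (a [ c ≔ w ]) j ⊎ Graph.Adj (Gs j) (a j) ((a [ c ≔ w ]) j)
      by-cases (yes refl) = inj₂ aᶜ~updated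
      by-cases (no j≢c)   = inj₁ ([≔]-unchanged a c w j j≢c)

module _ {k : ℕ} {Gs : Fin k → Graph} {U : (i : Fin k) → Subset (Graph.n (Gs i))}
         (R : Sub.Representation Gs U) where

  open Sub Gs U
  open Representation R

  colored-at-singleton : ∀ {c x a b} → InH x → SingletonS x → _≈P_ Gs (ψ a) x →
    SAdj Ks a b → DiffOnlyAt Ks c a b → Colored c x (ψ b)
  colored-at-singleton {a = a} {b} x∈H x-single ψa≈x a~b a-c-b =
    SAdj-resp-≈P Gs ψa≈x (λ _ → refl) (Equivalence.to (ψ-adj a b) a~b) ,
    (x∈H , ψ-inH b , inj₁ x-single) ,
    (a , b , ψa≈x , (λ _ → refl) , a-c-b)

  singleton-on-every-colour : ∀ {c x} → InH x → SingletonS x → InImage c →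
    ∃ λ y → Colored c x y
  singleton-on-every-colour {c} {x} x∈H x-single (_ , _ , _ , _ , (a , b , _ , _ , (aᶜ≢bᶜ , _)))
    with ψ-surj x x∈H
  ... | a₀ , ψa₀≈x with connected⇒∃-neighbour (Ks c) (Ks-conn c) aᶜ≢bᶜ (a₀ c)
  ...   | _ , a₀ᶜ~w with cartesian-neighbour Ks a₀ c a₀ᶜ~w
  ...     | b₀ , a₀~b₀ , a₀-c-b₀ =
    ψ b₀ , colored-at-singleton x∈H x-single ψa₀≈x a₀~b₀ a₀-c-b₀

lemma3p29 : (k : ℕ) (Gs : Fin k → Graph) → (∀ i → Connected (Gs i)) →
    Thin Gs →
    (U : (i : Fin k) → Subset (Graph.n (Gs i))) →
    (∀ i → ConnectedIn (Gs i) (U i)) →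
    Sub.NonThinH Gs U →
    (x : PVert Gs) → Sub.InH Gs U x → Sub.SingletonS Gs U x →
    (R : Sub.Representation Gs U) →
    (c : Fin (Sub.Representation.k' R)) → Sub.Representation.InImage R c →
    ∃ λ y → Sub.Representation.Colored R c x y ⊎ Sub.Representation.Colored R c y x
lemma3p29 _ _ _ _ _ _ _ x x∈H x-single R c c-used =
  let y , x-c-y = singleton-on-every-colour R x∈H x-single c-used
  in y , inj₁ x-c-y
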